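{- For every finite acyclic graph (forest) $G$ with at least one edge, $\gamma(G)\le \mathrm{rad}(G)$.
   Context: All graphs are finite, simple and undirected. A graph $G=(V,E)$ is a star-$k$-PCG if there exist a weight function $w:V\to\mathbb{R}^+$ and $k$ pairwise disjoint intervals $I_1,\dots,I_k$ such that for distinct $u,v\in V$, $uv\in E$ if and only if $w(u)+w(v)\in\bigcup_i I_i$. The star number $\gamma(G)$ is the least positive integer $k$ such that $G$ is a star-$k$-PCG. For a connected graph, the eccentricity of a vertex is its maximum distance to any other vertex and the radius is the minimum eccentricity; for a disconnected graph $G$, $\mathrm{rad}(G)$ is the maximum of the radii of its connected components. -}

module Defs where

open import Data.Nat as ℕ using (ℕ; zero; suc)
open import Data.Fin using (Fin; zero; suc; inject₁; fromℕ)
open import Data.Bool using (Bool; true)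
open import Data.Product using (Σ; ∃; ∃-syntax; _×_; _,_)
open import Data.Unit using (⊤)
open import Relation.Nullary using (¬_)
open import Relation.Binary.PropositionalEquality using (_≡_; _≢_)
open import Function.Definitions using (Injective)
open import Function.Bundles using (_⇔_)
open import Data.Rational as ℚ using (ℚ; 0ℚ)

record Graph (n : ℕ) : Set where
  field
    adj     : Fin n → Fin n → Bool
    adj-sym : ∀ u v → adj u v ≡ adj v u
    adj-irr : ∀ u → ¬ (adj u u ≡ true)
open Graph public

module _ {n : ℕ} (G : Graph n) where

  Edge : Fin n → Fin n → Set
  Edge u v = adj G u v ≡ true

  HasEdge : Set
  HasEdge = ∃[ u ] ∃[ v ] Edge u v

  Cycle : Set
  Cycle = ∃[ m ] Σ (Fin (suc (suc (suc m))) → Fin n) λ c →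
            Injective _≡_ _≡_ c
          × (∀ (i : Fin (suc (suc m))) → Edge (c (inject₁ i)) (c (suc i)))
          × Edge (c (fromℕ (suc (suc m)))) (c zero)

  Forest : Set
  Forest = ¬ Cycle

  data Walk : Fin n → Fin n → ℕ → Set where
    nil  : ∀ {u} → Walk u u 0
    cons : ∀ {u w v l} → Edge u w → Walk w v l → Walk u v (suc l)

  Reach : Fin n → Fin n → Set
  Reach u v = ∃[ l ] Walk u v l

  Dist : Fin n → Fin n → ℕ → Set
  Dist u v d = Walk u v d × (∀ l → Walk u v l → d ℕ.≤ l)

  Ecc : Fin n → ℕ → Set
  Ecc v e = (∀ u → Reach v u → ∃[ d ] (Dist v u d × d ℕ.≤ e))
          × (∃[ u ] Dist v u e)

  CompRad : Fin n → ℕ → Set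
  CompRad v r = (∃[ w ] (Reach v w × Ecc w r))
              × (∀ w e → Reach v w → Ecc w e → r ℕ.≤ e)

  Rad : ℕ → Set
  Rad r = (∃[ v ] CompRad v r) × (∀ v s → CompRad v s → s ℕ.≤ r)

data Bound : Set where
  ∞    : Bound
  incl : ℚ → Bound
  excl : ℚ → Bound

record Interval : Set where
  constructor ⟦_,_⟧
  field
    lower : Bound
    upper : Bound

_∈ᴵ_ : ℚ → Interval → Set
x ∈ᴵ ⟦ lo , hi ⟧ = Lo lo × Hi hi
  where
  Lo : Bound → Set
  Lo ∞        = ⊤
  Lo (incl a) = a ℚ.≤ x
  Lo (excl a) = a ℚ.< x
  Hi : Bound → Set
  Hi ∞        = ⊤
  Hi (incl b) = x ℚ.≤ b
  Hi (excl b) = x ℚ.< b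

StarPCG : ∀ {n} → Graph n → ℕ → Set
StarPCG {n} G k =
  Σ (Fin n → ℚ) λ w → Σ (Fin k → Interval) λ I →
      (∀ v → 0ℚ ℚ.< w v)
    × (∀ i j → i ≢ j → ∀ x → ¬ (x ∈ᴵ I i × x ∈ᴵ I j))
    × (∀ u v → u ≢ v → (Edge G u v ⇔ (∃[ i ] ((w u ℚ.+ w v) ∈ᴵ I i))))

StarNumber≤ : ∀ {n} → Graph n → ℕ → Set
StarNumber≤ G r = ∃[ k ] (1 ℕ.≤ k × k ℕ.≤ r × StarPCG G k)

module Submission where

-- Fix in every component a centre of eccentricity at most r (one exists because r is the
-- largest radius of a component) and let the level of a vertex be its distance from the
-- centre, so levels are at most r.  In a forest every edge joins a vertex to its parent, a
-- neighbour one level closer to the centre, so the edges are exactly the parent-child pairs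
-- on levels (j, j + 1) with j < r, and one interval per j suffices.  The weight of v is
-- Q·2^level(v) plus an entry below Q/2: the first term lets a sum of two weights reveal the
-- pair of levels; the entry is the code of v, the indices of the vertices on its path from
-- the root read as base-(n + 1) digits, mirrored as C - code on odd levels.  For u on level j
-- and v on level j + 1 the two entries then add up to C ∓ (code v - code u), which lies in a
-- narrow window exactly when u is the parent of v, because codes of distinct vertices on one
-- level are far apart.

open import Defs
open import Data.Nat as ℕ using (ℕ; zero; suc; _+_; _*_; _^_; _∸_; _≤_; _<_; z≤n; s≤s)
open import Data.Nat.Properties
open import Data.Nat.Induction using (<-rec)
open import Data.Nat.Solver using (module +-*-Solver)
open import Data.Nat.Coprimality as Coprime using (1-coprimeTo)
open import Data.Fin as Fin using (Fin; zero; suc; toℕ; inject₁; fromℕ)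
open import Data.Fin.Properties as Fin using (any?; pigeonhole)
open import Data.Bool using (Bool; true; false; not)
import Data.Bool.Properties as Bool
open import Data.Integer as ℤ using (+≤+; +<+)
import Data.Integer.Properties as ℤ
open import Data.Rational as ℚ using (ℚ; mkℚ; 0ℚ; *≤*; *<*)
import Data.Rational.Properties as ℚ
import Data.Rational.Unnormalised as ℚᵘ
import Data.Rational.Unnormalised.Properties as ℚᵘ
open import Data.Product using (∃; ∃-syntax; _×_; _,_; proj₁; proj₂; map; swap)
open import Data.Product.Function.NonDependent.Propositional using (_×-⇔_)
open import Data.Sum as Sum using (_⊎_; inj₁; inj₂; [_,_]′)
open import Data.Empty using (⊥; ⊥-elim)
open import Data.List using (List; []; _∷_; _∷ʳ_; length; lookup)
open import Data.List.Relation.Unary.All as All using (All; []; _∷_)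
import Data.List.Relation.Unary.All.Properties as All
open import Data.List.Relation.Unary.AllPairs using ([]; _∷_)
open import Data.List.Relation.Unary.Unique.Propositional using (Unique)
open import Data.List.Membership.Propositional.Properties using (∈-lookup)
open import Algebra.Properties.CommutativeSemigroup +-commutativeSemigroup using (xy∙z≈xz∙y)
open import Function using (_∘_; flip; id)
open import Function.Bundles using (_⇔_; mk⇔; Equivalence)
import Function.Properties.Equivalence as ⇔
open import Relation.Nullary using (¬_; Dec; yes; no)
open import Relation.Nullary.Decidable using (_×-dec_)
open import Relation.Unary using (Pred; Decidable)
open import Relation.Binary using (Rel; Transitive; Total; tri<; tri≈; tri>)
open import Relation.Binary.PropositionalEquality

minimal : ∀ {p} {P : Pred ℕ p} → Decidable P → ∀ {l} → P l →
          ∃[ d ] (P d × ∀ m → P m → d ≤ m)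
minimal P? {zero} Pl = 0 , Pl , λ _ _ → z≤n
minimal P? {suc l} Pl with P? 0
... | yes P0 = 0 , P0 , λ _ _ → z≤n
... | no ¬P0 with minimal (P? ∘ suc) Pl
...   | d , Pd , d-least = suc d , Pd , λ where
          zero P0     → ⊥-elim (¬P0 P0)
          (suc m) Psm → s≤s (d-least m Psm)

module _ {a ℓ} {A : Set a} {_≼_ : Rel A ℓ} (≼-trans : Transitive _≼_) (≼-total : Total _≼_) where

  private
    ≼-refl : ∀ {x} → x ≼ x
    ≼-refl {x} = [ id , id ]′ (≼-total x x)

  optimum : ∀ {m p} {Q : Pred (Fin m) p} → Decidable Q → (f : Fin m → A) → ∃ Q →
            ∃[ x ] (Q x × ∀ y → Q y → f x ≼ f y)
  optimum {suc m} {Q = Q} Q? f (x₀ , Qx₀) with any? (Q? ∘ suc)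
  ... | no ¬Qsuc = zero , Q0 x₀ Qx₀ , λ where
        zero    _   → ≼-refl
        (suc y) Qsy → ⊥-elim (¬Qsuc (y , Qsy))
    where
    Q0 : ∀ x → Q x → Q zero
    Q0 zero    Qx = Qx
    Q0 (suc x) Qx = ⊥-elim (¬Qsuc (x , Qx))
  ... | yes ∃Qsuc with optimum (Q? ∘ suc) (f ∘ suc) ∃Qsuc | Q? zero
  ...   | x , Qx , x-opt | no ¬Q0 = suc x , Qx , λ where
          zero    Q0  → ⊥-elim (¬Q0 Q0)
          (suc y) Qsy → x-opt y Qsy
  ...   | x , Qx , x-opt | yes Q0 with ≼-total (f zero) (f (suc x))
  ...     | inj₁ 0≼x = zero , Q0 , λ where
            zero    _   → ≼-refl
            (suc y) Qsy → ≼-trans 0≼x (x-opt y Qsy)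
  ...     | inj₂ x≼0 = suc x , Qx , λ where
            zero    _   → x≼0
            (suc y) Qsy → x-opt y Qsy


module _ {a} {A : Set a} where

  Unique-∷ʳ : ∀ {xs : List A} {y} → Unique xs → All (y ≢_) xs → Unique (xs ∷ʳ y)
  Unique-∷ʳ []         []           = [] ∷ []
  Unique-∷ʳ (x≢xs ∷ xs!) (y≢x ∷ y≢xs) = All.∷ʳ⁺ x≢xs (≢-sym y≢x) ∷ Unique-∷ʳ xs! y≢xs

  Unique⇒lookup-injective : ∀ {xs : List A} → Unique xs →
                            ∀ i j → lookup xs i ≡ lookup xs j → i ≡ j
  Unique⇒lookup-injective (x≢ ∷ _)   zero    zero    _  = refl
  Unique⇒lookup-injective (x≢ ∷ _)   zero    (suc j) eq = ⊥-elim (All.lookup x≢ (∈-lookup j) eq)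
  Unique⇒lookup-injective (x≢ ∷ _)   (suc i) zero    eq = ⊥-elim (All.lookup x≢ (∈-lookup i) (sym eq))
  Unique⇒lookup-injective (_  ∷ xs!) (suc i) (suc j) eq = cong suc (Unique⇒lookup-injective xs! i j eq)


-- Walks, distances and centres

module Walks {n : ℕ} (G : Graph n) where

  Edge-sym : ∀ {u v} → Edge G u v → Edge G v u
  Edge-sym {u} {v} e = trans (adj-sym G v u) e

  Edge-irrefl : ∀ {u v} → Edge G u v → u ≢ v
  Edge-irrefl {u} e refl = adj-irr G u e

  Edge? : ∀ u v → Dec (Edge G u v)
  Edge? u v = adj G u v Bool.≟ true

  snoc : ∀ {u v w l} → Walk G u v l → Edge G v w → Walk G u w (suc l)
  snoc nil        e = cons e nil
  snoc (cons f p) e = cons f (snoc p e)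

  reverse : ∀ {u v l} → Walk G u v l → Walk G v u l
  reverse nil        = nil
  reverse (cons e p) = snoc (reverse p) (Edge-sym e)

  _++ʷ_ : ∀ {u v w l m} → Walk G u v l → Walk G v w m → Walk G u w (l + m)
  nil      ++ʷ q = q
  cons e p ++ʷ q = cons e (p ++ʷ q)

  last-step : ∀ {u v l} → Walk G u v (suc l) → ∃[ x ] (Walk G u x l × Edge G x v)
  last-step (cons e nil)        = _ , nil , e
  last-step (cons e (cons f p)) with last-step (cons f p)
  ... | x , q , g = x , cons e q , g

  Walk₀ : ∀ {u v} → Walk G u v 0 → u ≡ v
  Walk₀ nil = refl

  vertexAt : ∀ {u v l} → Walk G u v l → Fin (suc l) → Fin n
  vertexAt {u} p          zero    = u
  vertexAt     (cons e p) (suc i) = vertexAt p i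

  suffix : ∀ {u v l} (p : Walk G u v l) (i : Fin (suc l)) →
           ∃[ l′ ] (l′ ≤ l × Walk G (vertexAt p i) v l′)
  suffix p          zero    = _ , ≤-refl , p
  suffix (cons e p) (suc i) with suffix p i
  ... | l′ , l′≤l , q = l′ , m≤n⇒m≤1+n l′≤l , q

  shortcut : ∀ {u v l} (p : Walk G u v l) {i j} → i Fin.< j → vertexAt p i ≡ vertexAt p j →
             ∃[ l′ ] (l′ < l × Walk G u v l′)
  shortcut (cons e p) {zero} {suc j} _ eq with suffix p j
  ... | l′ , l′≤l , q = l′ , s≤s l′≤l , subst (λ x → Walk G x _ l′) (sym eq) q
  shortcut (cons e p) {suc i} {suc j} (s≤s i<j) eq with shortcut p i<j eq
  ... | l′ , l′<l , q = suc l′ , s≤s l′<l , cons e q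

  -- Pigeonhole: a walk with at least n steps repeats a vertex.
  shorten : ∀ {u v l} → Walk G u v l → ∃[ l′ ] (l′ < n × Walk G u v l′)
  shorten {u} {v} {l} = <-rec P step l
    where
    P : ℕ → Set
    P l = Walk G u v l → ∃[ l′ ] (l′ < n × Walk G u v l′)
    step : ∀ l → (∀ {l′} → l′ < l → P l′) → P l
    step l rec p with l ℕ.<? n
    ... | yes l<n = l , l<n , p
    ... | no l≮n with pigeonhole (s≤s (≮⇒≥ l≮n)) (vertexAt p)
    ...   | i , j , i<j , eq with shortcut p i<j eq
    ...     | l′ , l′<l , q = rec l′<l q

  Walk? : ∀ l u v → Dec (Walk G u v l)
  Walk? zero u v with u Fin.≟ v
  ... | yes refl = yes nil
  ... | no u≢v   = no λ { nil → u≢v refl }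
  Walk? (suc l) u v with any? (λ w → Edge? u w ×-dec Walk? l w v)
  ... | yes (w , e , p) = yes (cons e p)
  ... | no ∄w           = no λ { (cons e p) → ∄w (_ , e , p) }

  Reach? : ∀ u v → Dec (Reach G u v)
  Reach? u v with any? (λ (i : Fin n) → Walk? (toℕ i) u v)
  ... | yes (i , p) = yes (toℕ i , p)
  ... | no ∄i       = no λ (_ , p) → let (l , l<n , q) = shorten p in
                        ∄i (Fin.fromℕ< l<n , subst (Walk G u v) (sym (Fin.toℕ-fromℕ< l<n)) q)

  Reach-refl : ∀ {u} → Reach G u u
  Reach-refl = 0 , nil

  Reach-sym : ∀ {u v} → Reach G u v → Reach G v u
  Reach-sym (l , p) = l , reverse p

  Reach-trans : ∀ {u v w} → Reach G u v → Reach G v w → Reach G u w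
  Reach-trans (l , p) (m , q) = l + m , p ++ʷ q

  Edge⇒Reach : ∀ {u v} → Edge G u v → Reach G u v
  Edge⇒Reach e = 1 , cons e nil

module Distances {n : ℕ} (G : Graph n) where
  open Walks G

  Dist-unique : ∀ {u v d d′} → Dist G u v d → Dist G u v d′ → d ≡ d′
  Dist-unique (p , p-min) (q , q-min) = ≤-antisym (p-min _ q) (q-min _ p)

  -- Junk value 0 for unreachable pairs.
  opaque
    dist : Fin n → Fin n → ℕ
    dist u v with Reach? u v
    ... | yes (_ , p) = proj₁ (minimal (λ l → Walk? l u v) p)
    ... | no _        = 0

    dist-spec : ∀ {u v} → Reach G u v → Dist G u v (dist u v)
    dist-spec {u} {v} u⇝v with Reach? u v
    ... | yes (_ , p) = proj₂ (minimal (λ l → Walk? l u v) p)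
    ... | no u↛v      = ⊥-elim (u↛v u⇝v)

  dist-minimal : ∀ {u v l} → Walk G u v l → dist u v ≤ l
  dist-minimal p = proj₂ (dist-spec (_ , p)) _ p

  opaque
    farthest-spec : ∀ w → ∃[ u ] (Reach G w u × ∀ u′ → Reach G w u′ → dist w u′ ≤ dist w u)
    farthest-spec w = optimum (flip ≤-trans) (flip ≤-total) (Reach? w) (dist w) (w , Reach-refl)

  farthest : Fin n → Fin n
  farthest w = proj₁ (farthest-spec w)

  ecc : Fin n → ℕ
  ecc w = dist w (farthest w)

  Reach-farthest : ∀ w → Reach G w (farthest w)
  Reach-farthest w = proj₁ (proj₂ (farthest-spec w))

  dist≤ecc : ∀ {w u} → Reach G w u → dist w u ≤ ecc w
  dist≤ecc {w} {u} = proj₂ (proj₂ (farthest-spec w)) u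

  ecc-spec : ∀ w → Ecc G w (ecc w)
  ecc-spec w =
    (λ u w⇝u → dist w u , dist-spec w⇝u , dist≤ecc w⇝u) , farthest w , dist-spec (Reach-farthest w)

  ecc-minimal : ∀ {w e} → Ecc G w e → ecc w ≤ e
  ecc-minimal {w} (bounded , _) with bounded (farthest w) (Reach-farthest w)
  ... | d , D , d≤e = subst (_≤ _) (Dist-unique D (dist-spec (Reach-farthest w))) d≤e

  compRad : ∀ v → ∃ (CompRad G v)
  compRad v with optimum ≤-trans ≤-total (Reach? v) ecc (v , Reach-refl)
  ... | w , v⇝w , w-min =
    ecc w , (w , v⇝w , ecc-spec w) , λ w′ _ v⇝w′ E → ≤-trans (w-min w′ v⇝w′) (ecc-minimal E)

record Rooting {n : ℕ} (G : Graph n) : Set where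
  field
    level       : Fin n → ℕ
    parent      : Fin n → Fin n
    parent-edge : ∀ {v k} → level v ≡ suc k → Edge G (parent v) v × level (parent v) ≡ k
    root-unique : ∀ {u v} → Reach G u v → level u ≡ 0 → level v ≡ 0 → u ≡ v

module Centres {n : ℕ} (G : Graph n) {r : ℕ} (rad : Rad G r) where
  open Walks G
  open Distances G

  Central : Fin n → Fin n → Set
  Central v w = Reach G v w × ecc w ≤ r

  Central? : ∀ v w → Dec (Central v w)
  Central? v w = Reach? v w ×-dec (ecc w ℕ.≤? r)

  central-exists : ∀ v → ∃ (Central v)
  central-exists v with compRad v
  ... | s , rad-v@((w , v⇝w , w-ecc) , _) =
    w , v⇝w , ≤-trans (ecc-minimal w-ecc) (proj₂ rad v s rad-v)

  -- The least central vertex: the canonical choice makes it depend on the component only.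
  opaque
    centre-spec : ∀ v → ∃[ w ] (Central v w × ∀ w′ → Central v w′ → w Fin.≤ w′)
    centre-spec v = optimum Fin.≤-trans Fin.≤-total (Central? v) id (central-exists v)

  centre : Fin n → Fin n
  centre v = proj₁ (centre-spec v)

  centre-central : ∀ v → Central v (centre v)
  centre-central v = proj₁ (proj₂ (centre-spec v))

  centre-least : ∀ {v w} → Central v w → centre v Fin.≤ w
  centre-least {v} {w} = proj₂ (proj₂ (centre-spec v)) w

  Central-Reach : ∀ {u v w} → Reach G u v → Central v w → Central u w
  Central-Reach u⇝v (v⇝w , w-ecc) = Reach-trans u⇝v v⇝w , w-ecc

  centre-cong : ∀ {u v} → Reach G u v → centre u ≡ centre v
  centre-cong {u} {v} u⇝v = Fin.≤-antisym
    (centre-least (Central-Reach u⇝v (centre-central v)))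
    (centre-least (Central-Reach (Reach-sym u⇝v) (centre-central u)))

  Reach-centre : ∀ v → Reach G (centre v) v
  Reach-centre v = Reach-sym (proj₁ (centre-central v))

  level : Fin n → ℕ
  level v = dist (centre v) v

  level≤r : ∀ v → level v ≤ r
  level≤r v = ≤-trans (dist≤ecc (Reach-centre v)) (proj₂ (centre-central v))

  geodesic : ∀ v → Walk G (centre v) v (level v)
  geodesic v = proj₁ (dist-spec (Reach-centre v))

  level-edge : ∀ {u v} → Edge G u v → level v ≤ suc (level u)
  level-edge {u} {v} e =
    dist-minimal (subst (λ c → Walk G c v _) (centre-cong (Edge⇒Reach e)) (snoc (geodesic u) e))

  IsParent : Fin n → Fin n → Set
  IsParent v u = Edge G u v × suc (level u) ≡ level v

  IsParent? : ∀ v u → Dec (IsParent v u)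
  IsParent? v u = Edge? u v ×-dec (suc (level u) ℕ.≟ level v)

  -- The last step of a geodesic from the centre.
  parent-exists : ∀ {v k} → level v ≡ suc k → ∃ (IsParent v)
  parent-exists {v} {k} eq with last-step (subst (Walk G (centre v) v) eq (geodesic v))
  ... | u , p , e = u , e , trans (cong suc (≤-antisym level-u≤k k≤level-u)) (sym eq)
    where
    level-u≤k : level u ≤ k
    level-u≤k = dist-minimal (subst (λ c → Walk G c u k) (sym (centre-cong (Edge⇒Reach e))) p)
    k≤level-u : k ≤ level u
    k≤level-u = ℕ.s≤s⁻¹ (subst (_≤ suc (level u)) eq (level-edge e))

  opaque
    parent : Fin n → Fin n
    parent v with any? (IsParent? v)
    ... | yes (u , _) = u
    ... | no _        = v

    parent-spec : ∀ {v k} → level v ≡ suc k → IsParent v (parent v)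
    parent-spec {v} eq with any? (IsParent? v)
    ... | yes (_ , u-parent) = u-parent
    ... | no ∄parent         = ⊥-elim (∄parent (parent-exists eq))

  root-centre : ∀ {v} → level v ≡ 0 → centre v ≡ v
  root-centre {v} eq = Walk₀ (subst (Walk G (centre v) v) eq (geodesic v))

  rooting : Rooting G
  rooting = record
    { level       = level
    ; parent      = parent
    ; parent-edge = λ eq → proj₁ (parent-spec eq) , suc-injective (trans (proj₂ (parent-spec eq)) eq)
    ; root-unique = λ u⇝v u-root v-root →
        trans (sym (root-centre u-root)) (trans (centre-cong u⇝v) (root-centre v-root))
    }


-- Forests

module Paths {n : ℕ} (G : Graph n) where

  -- A path x ⋯ y lists the vertices after x.
  data Path : Fin n → Fin n → List (Fin n) → Set where
    []  : ∀ {x} → Path x x []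
    _∷_ : ∀ {x y z zs} → Edge G x y → Path y z zs → Path x z (y ∷ zs)

  Path-∷ʳ : ∀ {x y z zs} → Path x y zs → Edge G y z → Path x z (zs ∷ʳ z)
  Path-∷ʳ []      f = f ∷ []
  Path-∷ʳ (e ∷ p) f = e ∷ Path-∷ʳ p f

  Path-edge : ∀ {x y zs} → Path x y zs → ∀ (i : Fin (length zs)) →
              Edge G (lookup (x ∷ zs) (inject₁ i)) (lookup (x ∷ zs) (suc i))
  Path-edge (e ∷ p) zero    = e
  Path-edge (e ∷ p) (suc i) = Path-edge p i

  Path-last : ∀ {x y zs} → Path x y zs → lookup (x ∷ zs) (fromℕ (length zs)) ≡ y
  Path-last []      = refl
  Path-last (e ∷ p) = Path-last p

  close-cycle : ∀ {v x y zs} → Path x y zs → x ≢ y → Unique (x ∷ zs) → All (v ≢_) (x ∷ zs) →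
                Edge G v x → Edge G y v → Cycle G
  close-cycle []                  x≢y _ _  _ _ = ⊥-elim (x≢y refl)
  close-cycle {v} {x} {zs = a ∷ rest} p _ u v∉ e f =
    length rest , lookup (v ∷ x ∷ a ∷ rest) ,
    (λ {i} {j} → Unique⇒lookup-injective (v∉ ∷ u) i j) ,
    Path-edge (e ∷ p) , subst (λ z → Edge G z v) (sym (Path-last p)) f

module TreeEdges {n : ℕ} {G : Graph n} (R : Rooting G) where
  open Rooting R
  open Walks G
  open Paths G

  _⊴_ : Fin n → Fin n → Set
  z ⊴ y = z ≡ y ⊎ level z < level y

  level-parent< : ∀ {y k} → level y ≡ suc k → level (parent y) < level y
  level-parent< eq = subst₂ _<_ (sym (proj₂ (parent-edge eq))) (sym eq) (n<1+n _)

  ⊴-parent : ∀ {y z k} → level y ≡ suc k → z ⊴ parent y → z ⊴ y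
  ⊴-parent eq (inj₁ refl) = inj₂ (level-parent< eq)
  ⊴-parent eq (inj₂ z<p)  = inj₂ (<-trans z<p (level-parent< eq))

  ⋬-parent : ∀ {y k} → level y ≡ suc k → ¬ y ⊴ parent y
  ⋬-parent eq (inj₁ y≡p) = <-irrefl (cong level (sym y≡p)) (level-parent< eq)
  ⋬-parent eq (inj₂ y<p) = <-asym y<p (level-parent< eq)

  ⋬-lower : ∀ {y y′} → y ≢ y′ → level y′ ≤ level y → ¬ y ⊴ y′
  ⋬-lower y≢y′ _      (inj₁ y≡y′) = y≢y′ y≡y′
  ⋬-lower _    y′≤y (inj₂ y<y′)   = <⇒≱ y<y′ y′≤y

  avoids : ∀ {y a b zs} → ¬ y ⊴ a → ¬ y ⊴ b → All (λ z → z ⊴ a ⊎ z ⊴ b) zs → All (y ≢_) zs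
  avoids ⋬a ⋬b = All.map λ where
    (inj₁ z⊴a) refl → ⋬a z⊴a
    (inj₂ z⊴b) refl → ⋬b z⊴b

  climbable : ∀ {y y′} → Reach G y y′ → y ≢ y′ → level y′ ≤ level y → ∃[ k ] (level y ≡ suc k)
  climbable {y} {y′} y⇝y′ y≢y′ y′≤y with level y in eq
  ... | suc k = k , refl
  ... | zero  = ⊥-elim (y≢y′ (root-unique y⇝y′ eq (n≤0⇒n≡0 y′≤y)))

  edge-nonroot : ∀ {u v} → Edge G u v → ∃[ w ] ∃[ k ] (level w ≡ suc k)
  edge-nonroot {u} {v} e with ≤-total (level v) (level u)
  ... | inj₁ v≤u = u , climbable (Edge⇒Reach e) (Edge-irrefl e) v≤u
  ... | inj₂ u≤v = v , climbable (Edge⇒Reach (Edge-sym e)) (Edge-irrefl (Edge-sym e)) u≤v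

  depth≥1 : ∀ {r u v} → (∀ w → level w ≤ r) → Edge G u v → 1 ≤ r
  depth≥1 level≤r e with edge-nonroot e
  ... | w , _ , eq = ≤-trans (s≤s z≤n) (subst (_≤ _) eq (level≤r w))

  -- Every vertex of a tree path lies weakly below one of its ends, which keeps the path
  -- simple when it is extended at an end that is at least as deep as the other.
  TreePath : Fin n → Fin n → Set
  TreePath y y′ = ∃[ zs ] (Path y y′ zs × Unique (y ∷ zs) × All (λ z → z ⊴ y ⊎ z ⊴ y′) (y ∷ zs))

  climb-left : ∀ {y y′ k} → level y ≡ suc k → y ≢ y′ → level y′ ≤ level y →
               TreePath (parent y) y′ → TreePath y y′
  climb-left {y} ey y≢y′ y′≤y (zs , p , u , below) =
    parent y ∷ zs , Edge-sym (proj₁ (parent-edge ey)) ∷ p ,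
    avoids (⋬-parent ey) (⋬-lower y≢y′ y′≤y) below ∷ u ,
    inj₁ (inj₁ refl) ∷ All.map (Sum.map₁ (⊴-parent ey)) below

  climb-right : ∀ {y y′ k} → level y′ ≡ suc k → y ≢ y′ → level y ≤ level y′ →
                TreePath y (parent y′) → TreePath y y′
  climb-right {y′ = y′} ey′ y≢y′ y≤y′ (zs , p , u , below) =
    zs ∷ʳ y′ , Path-∷ʳ p (proj₁ (parent-edge ey′)) ,
    Unique-∷ʳ u (avoids (⋬-lower (≢-sym y≢y′) y≤y′) (⋬-parent ey′) below) ,
    All.∷ʳ⁺ (All.map (Sum.map₂ (⊴-parent ey′)) below) (inj₂ (inj₁ refl))

  tree-path : ∀ {y y′} → Reach G y y′ → TreePath y y′
  tree-path {y} {y′} = <-rec P step (level y + level y′) refl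
    where
    P : ℕ → Set
    P s = ∀ {y y′} → level y + level y′ ≡ s → Reach G y y′ → TreePath y y′
    step : ∀ s → (∀ {s′} → s′ < s → P s′) → P s
    step s rec {y} {y′} eq y⇝y′ with y Fin.≟ y′
    ... | yes refl = [] , [] , [] ∷ [] , inj₁ (inj₁ refl) ∷ []
    ... | no y≢y′ with ≤-total (level y′) (level y)
    ...   | inj₁ y′≤y with climbable y⇝y′ y≢y′ y′≤y
    ...     | _ , ey = climb-left ey y≢y′ y′≤y
                (rec (subst (_ <_) eq (+-monoˡ-< (level y′) (level-parent< ey))) refl
                     (Reach-trans (Edge⇒Reach (proj₁ (parent-edge ey))) y⇝y′))
    step s rec {y} {y′} eq y⇝y′ | no y≢y′ | inj₂ y≤y′
      with climbable (Reach-sym y⇝y′) (≢-sym y≢y′) y≤y′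
    ...     | _ , ey′ = climb-right ey′ y≢y′ y≤y′
                (rec (subst (_ <_) eq (+-monoʳ-< (level y) (level-parent< ey′))) refl
                     (Reach-trans y⇝y′ (Edge⇒Reach (Edge-sym (proj₁ (parent-edge ey′))))))

  -- Otherwise the tree path from the parent of v to u closes up through v to a cycle.
  tree-edge : Forest G → ∀ {u v} → Edge G u v → level u ≤ level v →
              u ≡ parent v × level v ≡ suc (level u)
  tree-edge forest {u} {v} e u≤v with climbable (Edge⇒Reach (Edge-sym e)) (≢-sym (Edge-irrefl e)) u≤v
  ... | _ , ev with u Fin.≟ parent v
  ...   | yes refl = refl , trans ev (cong suc (sym (proj₂ (parent-edge ev))))
  ...   | no u≢p
    with tree-path (Reach-trans (Edge⇒Reach (proj₁ (parent-edge ev))) (Edge⇒Reach (Edge-sym e)))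
  ...     | _ , p , unique , below = ⊥-elim (forest (close-cycle p (≢-sym u≢p) unique
              (avoids (⋬-parent ev) (⋬-lower (≢-sym (Edge-irrefl e)) u≤v) below)
              (Edge-sym (proj₁ (parent-edge ev))) e))

-- Arithmetic

Apart : ℕ → ℕ → ℕ → Set
Apart d x y = x + d ≤ y ⊎ y + d ≤ x

digit-gap : ∀ a {x y} h → x < y → a + x * h + h ≤ a + y * h
digit-gap a {x} {y} h x<y = subst (_≤ a + y * h) (sym regroup) (+-monoʳ-≤ a (*-monoˡ-≤ h x<y))
  where
  regroup : a + x * h + h ≡ a + suc x * h
  regroup = trans (+-assoc a (x * h) h) (cong (a +_) (+-comm (x * h) h))

carry-gap : ∀ {a a′ b x} y h → a + b * h ≤ a′ → x < b → a + x * h + h ≤ a′ + y * h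
carry-gap {a} {a′} {b} {x} y h gap x<b = begin
  a + x * h + h   ≤⟨ digit-gap a h x<b ⟩
  a + b * h       ≤⟨ gap ⟩
  a′              ≤⟨ m≤m+n a′ (y * h) ⟩
  a′ + y * h      ∎
  where open ≤-Reasoning

digits-apart : ∀ a {x y} h → x ≢ y → Apart h (a + x * h) (a + y * h)
digits-apart a {x} {y} h x≢y with <-cmp x y
... | tri< x<y _ _ = inj₁ (digit-gap a h x<y)
... | tri≈ _ x≡y _ = ⊥-elim (x≢y x≡y)
... | tri> _ _ y<x = inj₂ (digit-gap a h y<x)

carry-apart : ∀ {a a′ b x y} h → Apart (b * h) a a′ → x < b → y < b → Apart h (a + x * h) (a′ + y * h)
carry-apart {y = y} h (inj₁ gap) x<b _   = inj₁ (carry-gap y h gap x<b)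
carry-apart {x = x} h (inj₂ gap) _   y<b = inj₂ (carry-gap x h gap y<b)

apart-outside : ∀ {g x y t T} → Apart g x y → t ≤ T → T < g → x ≤ y + t → y + t ≤ x + T → ⊥
apart-outside {g} {x} {y} {t} {T} (inj₁ x+g≤y) _ T<g _ y+t≤x+T = <-irrefl refl (begin-strict
  x + T   <⟨ +-monoʳ-< x T<g ⟩
  x + g   ≤⟨ x+g≤y ⟩
  y       ≤⟨ m≤m+n y t ⟩
  y + t   ≤⟨ y+t≤x+T ⟩
  x + T   ∎)
  where open ≤-Reasoning
apart-outside {g} {x} {y} {t} {T} (inj₂ y+g≤x) t≤T T<g x≤y+t _ = <-irrefl refl (begin-strict
  y + t   ≤⟨ +-monoʳ-≤ y t≤T ⟩
  y + T   <⟨ +-monoʳ-< y T<g ⟩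
  y + g   ≤⟨ y+g≤x ⟩
  x       ≤⟨ x≤y+t ⟩
  y + t   ∎)
  where open ≤-Reasoning

+-cancelˡ-⇔ : ∀ k {m n} → (k + m ≤ k + n) ⇔ (m ≤ n)
+-cancelˡ-⇔ k {m} {n} = mk⇔ (+-cancelˡ-≤ k m n) (+-monoʳ-≤ k)

+-cancelʳ-⇔ : ∀ k {m n} → (m + k ≤ n + k) ⇔ (m ≤ n)
+-cancelʳ-⇔ k {m} {n} = mk⇔ (+-cancelʳ-≤ k m n) (+-monoˡ-≤ k)

∸-≤-⇔ : ∀ {m n o} → (m ∸ n ≤ o) ⇔ (m ≤ o + n)
∸-≤-⇔ {m} {n} {o} = mk⇔
  (λ m∸n≤o → ≤-trans (m≤n+m∸n m n) (subst (n + (m ∸ n) ≤_) (+-comm n o) (+-monoʳ-≤ n m∸n≤o)))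
  (λ m≤o+n → m≤n+o⇒m∸n≤o m n (subst (m ≤_) (+-comm o n) m≤o+n))

-- Of the codes x of a lower and y of an upper vertex exactly one is mirrored at C, so the
-- sum of the two entries is C ∓ (y - x), and the window for it tests x ≤ y ≤ x + T.
module Window (C : ℕ) where

  mirror : Bool → ℕ → ℕ
  mirror false x = x
  mirror true  x = C ∸ x

  window-lo window-hi : Bool → ℕ → ℕ
  window-lo false T = C ∸ T
  window-lo true  T = C
  window-hi false T = C
  window-hi true  T = C + T

  InWindow : Bool → ℕ → ℕ → Set
  InWindow s T S = window-lo s T ≤ S × S ≤ window-hi s T

  window : ∀ s T {x y} → x ≤ C → y ≤ C →
           InWindow s T (mirror s x + mirror (not s) y) ⇔ (x ≤ y × y ≤ x + T)
  window false T {x} {y} _ y≤C = ⇔.trans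
    (⇔.trans ∸-≤-⇔ (subst₂ (λ a b → (a ≤ b) ⇔ (y ≤ x + T))
                           (m+[n∸m]≡n y≤C) (xy∙z≈xz∙y x T (C ∸ y)) (+-cancelʳ-⇔ (C ∸ y)))
     ×-⇔ subst (λ c → (x + (C ∸ y) ≤ c) ⇔ (x ≤ y)) (m+[n∸m]≡n y≤C) (+-cancelʳ-⇔ (C ∸ y)))
    (mk⇔ swap swap)
  window true T {x} {y} x≤C _ =
    subst₂ (λ a b → (a ≤ b) ⇔ (x ≤ y)) (m+[n∸m]≡n x≤C) (+-comm y (C ∸ x)) (+-cancelʳ-⇔ (C ∸ x))
    ×-⇔ subst₂ (λ a b → (a ≤ b) ⇔ (y ≤ x + T))
               (+-comm y (C ∸ x)) (trans (xy∙z≈xz∙y x T (C ∸ x)) (cong (_+ T) (m+[n∸m]≡n x≤C)))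
               (+-cancelʳ-⇔ (C ∸ x))

  mirror-≤ : ∀ s {x} → x ≤ C → mirror s x ≤ C
  mirror-≤ false x≤C = x≤C
  mirror-≤ true  {x} _ = m∸n≤m C x

  window-hi≤ : ∀ s T → window-hi s T ≤ C + T
  window-hi≤ false T = m≤m+n C T
  window-hi≤ true  T = ≤-refl

quotient-≤ : ∀ Q {X Y s hi} → hi < Q → Q * Y ≤ s → s ≤ Q * X + hi → Y ≤ X
quotient-≤ Q {X} {Y} {s} {hi} hi<Q QY≤s s≤QX+hi = ℕ.s≤s⁻¹ (*-cancelˡ-< Q Y (suc X) (begin-strict
  Q * Y       ≤⟨ QY≤s ⟩
  s           ≤⟨ s≤QX+hi ⟩
  Q * X + hi  <⟨ +-monoʳ-< (Q * X) hi<Q ⟩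
  Q * X + Q   ≡⟨ trans (+-comm (Q * X) Q) (sym (*-suc Q X)) ⟩
  Q * suc X   ∎))
  where open ≤-Reasoning

2^-injective : ∀ {a b} → 2 ^ a ≡ 2 ^ b → a ≡ b
2^-injective {a} {b} eq with <-cmp a b
... | tri< a<b _ _ = ⊥-elim (<-irrefl eq (^-monoʳ-< 2 (s≤s (s≤s z≤n)) a<b))
... | tri≈ _ a≡b _ = a≡b
... | tri> _ _ b<a = ⊥-elim (<-irrefl (sym eq) (^-monoʳ-< 2 (s≤s (s≤s z≤n)) b<a))

2^-double : ∀ k → 2 ^ k + 2 ^ k ≡ 2 ^ suc k
2^-double k = cong (2 ^ k +_) (sym (+-identityʳ (2 ^ k)))

2^-pair : ∀ {a b j} → a ≤ b → 2 ^ a + 2 ^ b ≡ 2 ^ j + 2 ^ suc j → a ≡ j × b ≡ suc j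
2^-pair {a} {b} {j} a≤b eq with <-cmp b (suc j)
... | tri< b<1+j _ _ = ⊥-elim (<-irrefl eq (begin-strict
  2 ^ a + 2 ^ b        ≤⟨ +-monoˡ-≤ (2 ^ b) (^-monoʳ-≤ 2 a≤b) ⟩
  2 ^ b + 2 ^ b        ≡⟨ 2^-double b ⟩
  2 ^ suc b            ≤⟨ ^-monoʳ-≤ 2 b<1+j ⟩
  2 ^ suc j            <⟨ m<n+m (2 ^ suc j) (m^n>0 2 j) ⟩
  2 ^ j + 2 ^ suc j    ∎))
  where open ≤-Reasoning
... | tri> _ _ 1+j<b = ⊥-elim (<-irrefl (sym eq) (begin-strict
  2 ^ j + 2 ^ suc j        <⟨ +-monoˡ-< (2 ^ suc j) (^-monoʳ-< 2 (s≤s (s≤s z≤n)) (n<1+n j)) ⟩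
  2 ^ suc j + 2 ^ suc j    ≡⟨ 2^-double (suc j) ⟩
  2 ^ suc (suc j)          ≤⟨ ^-monoʳ-≤ 2 1+j<b ⟩
  2 ^ b                    ≤⟨ m≤n+m (2 ^ b) (2 ^ a) ⟩
  2 ^ a + 2 ^ b            ∎))
  where open ≤-Reasoning
... | tri≈ _ refl _ = 2^-injective (+-cancelʳ-≡ (2 ^ suc j) (2 ^ a) (2 ^ j) eq) , refl

toℚ : ℕ → ℚ
toℚ a = mkℚ (ℤ.+ a) 0 (Coprime.sym (1-coprimeTo a))

toℚ-+ : ∀ a b → toℚ a ℚ.+ toℚ b ≡ toℚ (a + b)
toℚ-+ a b = ℚ.toℚᵘ-injective
  (ℚᵘ.≃-trans (ℚ.toℚᵘ-homo-+ (toℚ a) (toℚ b)) (ℚᵘ.*≡* (cong (ℤ._* ℤ.+ 1) sum)))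
  where
  sum : ℤ.+ a ℤ.* ℤ.+ 1 ℤ.+ ℤ.+ b ℤ.* ℤ.+ 1 ≡ ℤ.+ (a + b)
  sum = trans (cong₂ ℤ._+_ (ℤ.*-identityʳ (ℤ.+ a)) (ℤ.*-identityʳ (ℤ.+ b))) (sym (ℤ.pos-+ a b))

toℚ-mono-≤ : ∀ {a b} → a ≤ b → toℚ a ℚ.≤ toℚ b
toℚ-mono-≤ {a} {b} a≤b =
  *≤* (subst₂ ℤ._≤_ (sym (ℤ.*-identityʳ (ℤ.+ a))) (sym (ℤ.*-identityʳ (ℤ.+ b))) (+≤+ a≤b))

toℚ-cancel-≤ : ∀ {a b} → toℚ a ℚ.≤ toℚ b → a ≤ b
toℚ-cancel-≤ {a} {b} (*≤* a≤b)
  with subst₂ ℤ._≤_ (ℤ.*-identityʳ (ℤ.+ a)) (ℤ.*-identityʳ (ℤ.+ b)) a≤b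
... | +≤+ a≤b′ = a≤b′

toℚ-pos : ∀ {a} → 0 < a → 0ℚ ℚ.< toℚ a
toℚ-pos {a} 0<a = *<* (subst (ℤ._<_ _) (sym (ℤ.*-identityʳ (ℤ.+ a))) (+<+ 0<a))

-- Weights and intervals

module Construction {n : ℕ} {G : Graph n} (level : Fin n → ℕ) (parent : Fin n → Fin n) {r : ℕ}
  (level≤r : ∀ v → level v ≤ r)
  (parent-edge : ∀ {v k} → level v ≡ suc k → Edge G (parent v) v × level (parent v) ≡ k)
  (tree-edge : ∀ {u v} → Edge G u v → level u ≤ level v →
               u ≡ parent v × level v ≡ suc (level u)) where
  open Walks G using (Edge-sym)

  base : ℕ
  base = suc n

  scale : ℕ → ℕ
  scale j = base ^ (r ∸ j)

  scale-step : ∀ {j} → j < r → scale j ≡ base * scale (suc j)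
  scale-step j<r = cong (base ^_) (+-∸-assoc 1 j<r)

  C : ℕ
  C = base * scale 0

  scale≤C : ∀ j → scale j ≤ C
  scale≤C j = ≤-trans (^-monoʳ-≤ base (m∸n≤m r j)) (m≤n*m (scale 0) base)

  digit<base : ∀ (v : Fin n) → toℕ v < base
  digit<base v = m<n⇒m<1+n (Fin.toℕ<n v)

  -- The indices of the vertices on the path from the root, as base-(n + 1) digits.
  codeAt : ℕ → Fin n → ℕ
  codeAt zero    v = toℕ v * scale 0
  codeAt (suc k) v = codeAt k (parent v) + toℕ v * scale (suc k)

  code : Fin n → ℕ
  code v = codeAt (level v) v

  codeAt-bound : ∀ k v → k ≤ r → codeAt k v + scale k ≤ C
  codeAt-bound zero    v _   = digit-gap 0 (scale 0) (digit<base v)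
  codeAt-bound (suc k) v k<r = begin
    a + toℕ v * h + h   ≤⟨ digit-gap a h (digit<base v) ⟩
    a + base * h        ≡⟨ cong (a +_) (sym (scale-step k<r)) ⟩
    a + scale k         ≤⟨ codeAt-bound k (parent v) (<⇒≤ k<r) ⟩
    C                   ∎
    where
    open ≤-Reasoning
    a h : ℕ
    a = codeAt k (parent v)
    h = scale (suc k)

  code≤C : ∀ v → code v ≤ C
  code≤C v = m+n≤o⇒m≤o (code v) (codeAt-bound (level v) v (level≤r v))

  code-parent : ∀ {v k} → level v ≡ suc k → code v ≡ code (parent v) + toℕ v * scale (suc k)
  code-parent {v} {k} ev = trans (cong (λ l → codeAt l v) ev)
    (cong (λ l → codeAt l (parent v) + toℕ v * scale (suc k)) (sym (proj₂ (parent-edge ev))))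

  codes-apart : ∀ j {u u′} → level u ≡ j → level u′ ≡ j → u ≢ u′ →
                Apart (scale j) (code u) (code u′)
  codes-apart zero {u} {u′} eu eu′ u≢u′ =
    subst₂ (Apart (scale 0)) (cong (λ l → codeAt l u) (sym eu)) (cong (λ l → codeAt l u′) (sym eu′))
      (digits-apart 0 (scale 0) (u≢u′ ∘ Fin.toℕ-injective))
  codes-apart (suc k) {u} {u′} eu eu′ u≢u′
    rewrite code-parent eu | code-parent eu′ with parent u Fin.≟ parent u′
  ... | yes pu≡pu′ rewrite pu≡pu′ =
    digits-apart (code (parent u′)) (scale (suc k)) (u≢u′ ∘ Fin.toℕ-injective)
  ... | no pu≢pu′ = carry-apart (scale (suc k))
    (subst (λ h → Apart h _ _) (scale-step k<r)
      (codes-apart k (level-parent eu) (level-parent eu′) pu≢pu′))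
    (digit<base u) (digit<base u′)
    where
    level-parent : ∀ {v} → level v ≡ suc k → level (parent v) ≡ k
    level-parent ev = proj₂ (parent-edge ev)
    k<r : k < r
    k<r = subst (_≤ r) eu (level≤r u)

  open Window C

  odd : ℕ → Bool
  odd zero    = false
  odd (suc k) = not (odd k)

  entry : Fin n → ℕ
  entry v = mirror (odd (level v)) (code v)

  tolerance : ℕ → ℕ
  tolerance j = n * scale (suc j)

  digit≤tolerance : ∀ (v : Fin n) j → toℕ v * scale (suc j) ≤ tolerance j
  digit≤tolerance v j = *-monoˡ-≤ (scale (suc j)) (<⇒≤ (Fin.toℕ<n v))

  tolerance<scale : ∀ {j} → j < r → tolerance j < scale j
  tolerance<scale {j} j<r =
    subst (tolerance j <_) (sym (scale-step j<r)) (m<n+m (tolerance j) (m^n>0 base (r ∸ suc j)))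

  parent⇔window : ∀ {u v j} → j < r → level u ≡ j → level v ≡ suc j →
                  (u ≡ parent v) ⇔ InWindow (odd j) (tolerance j) (entry u + entry v)
  parent⇔window {u} {v} {j} j<r eu ev = ⇔.trans parent⇔between (⇔.sym (subst
    (λ S → InWindow (odd j) (tolerance j) S ⇔ (code u ≤ code v × code v ≤ code u + tolerance j))
    (sym entries) (window (odd j) (tolerance j) (code≤C u) (code≤C v))))
    where
    entries : entry u + entry v ≡ mirror (odd j) (code u) + mirror (not (odd j)) (code v)
    entries = cong₂ (λ a b → mirror (odd a) (code u) + mirror (odd b) (code v)) eu ev
    parent⇔between : (u ≡ parent v) ⇔ (code u ≤ code v × code v ≤ code u + tolerance j)
    parent⇔between rewrite code-parent ev = mk⇔
      (λ { refl → m≤m+n _ _ , +-monoʳ-≤ _ (digit≤tolerance v j) })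
      (λ (lower , upper) → case-parent lower upper)
      where
      case-parent : code u ≤ code (parent v) + toℕ v * scale (suc j) →
                    code (parent v) + toℕ v * scale (suc j) ≤ code u + tolerance j → u ≡ parent v
      case-parent lower upper with u Fin.≟ parent v
      ... | yes u≡p = u≡p
      ... | no u≢p  = ⊥-elim (apart-outside (codes-apart j eu (proj₂ (parent-edge ev)) u≢p)
                                (digit≤tolerance v j) (tolerance<scale j<r) lower upper)

  -- Q exceeds the sum of any two entries, so a sum of two weights determines the levels.
  Q : ℕ
  Q = suc (C + C)

  weight : Fin n → ℕ
  weight v = Q * 2 ^ level v + entry v

  pair : ℕ → ℕ
  pair j = 2 ^ j + 2 ^ suc j

  slot-lo slot-hi : ℕ → ℕ
  slot-lo j = Q * pair j + window-lo (odd j) (tolerance j)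
  slot-hi j = Q * pair j + window-hi (odd j) (tolerance j)

  InSlot : ℕ → ℕ → Set
  InSlot j S = slot-lo j ≤ S × S ≤ slot-hi j

  entries<Q : ∀ u v → entry u + entry v < Q
  entries<Q u v =
    s≤s (+-mono-≤ (mirror-≤ (odd (level u)) (code≤C u)) (mirror-≤ (odd (level v)) (code≤C v)))

  window-hi<Q : ∀ {j} → j < r → window-hi (odd j) (tolerance j) < Q
  window-hi<Q {j} j<r = s≤s (≤-trans (window-hi≤ (odd j) (tolerance j))
    (+-monoʳ-≤ C (≤-trans (<⇒≤ (tolerance<scale j<r)) (scale≤C j))))

  weight-sum : ∀ u v → weight u + weight v ≡ Q * (2 ^ level u + 2 ^ level v) + (entry u + entry v)
  weight-sum u v = solve 5 (λ q a b x y → (q :* a :+ x) :+ (q :* b :+ y) := q :* (a :+ b) :+ (x :+ y))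
    refl Q (2 ^ level u) (2 ^ level v) (entry u) (entry v)
    where open +-*-Solver

  slot-levels : ∀ {u v j} → j < r → level u ≤ level v → InSlot j (weight u + weight v) →
                level u ≡ j × level v ≡ suc j
  slot-levels {u} {v} {j} j<r u≤v (lo≤S , S≤hi) = 2^-pair u≤v (≤-antisym
    (quotient-≤ Q (window-hi<Q j<r) (subst (Q * levels ≤_) (sym (weight-sum u v)) (m≤m+n _ _)) S≤hi)
    (quotient-≤ Q (entries<Q u v) (≤-trans (m≤m+n _ _) lo≤S) (≤-reflexive (weight-sum u v))))
    where
    levels : ℕ
    levels = 2 ^ level u + 2 ^ level v

  slot⇔window : ∀ {u v j} → level u ≡ j → level v ≡ suc j →
                InSlot j (weight u + weight v) ⇔ InWindow (odd j) (tolerance j) (entry u + entry v)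
  slot⇔window {u} {v} {j} eu ev =
    subst (λ S → InSlot j S ⇔ InWindow (odd j) (tolerance j) (entry u + entry v))
      (sym (trans (weight-sum u v) (cong₂ (λ a b → Q * (2 ^ a + 2 ^ b) + (entry u + entry v)) eu ev)))
      (+-cancelˡ-⇔ (Q * pair j) ×-⇔ +-cancelˡ-⇔ (Q * pair j))

  upward-edge⇔slot : ∀ {u v} → level u ≤ level v →
                     Edge G u v ⇔ (∃[ j ] (j < r × InSlot j (weight u + weight v)))
  upward-edge⇔slot {u} {v} u≤v = mk⇔ to from
    where
    to : Edge G u v → ∃[ j ] (j < r × InSlot j (weight u + weight v))
    to e with tree-edge e u≤v
    ... | u≡p , ev = level u , j<r , Equivalence.from (slot⇔window refl ev)
                                        (Equivalence.to (parent⇔window j<r refl ev) u≡p)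
      where
      j<r : level u < r
      j<r = subst (_≤ r) ev (level≤r v)
    from : ∃[ j ] (j < r × InSlot j (weight u + weight v)) → Edge G u v
    from (j , j<r , slot) with slot-levels j<r u≤v slot
    ... | eu , ev = subst (λ x → Edge G x v)
          (sym (Equivalence.from (parent⇔window j<r eu ev) (Equivalence.to (slot⇔window eu ev) slot)))
          (proj₁ (parent-edge ev))

  edge⇔slot : ∀ u v → Edge G u v ⇔ (∃[ j ] (j < r × InSlot j (weight u + weight v)))
  edge⇔slot u v with ≤-total (level u) (level v)
  ... | inj₁ u≤v = upward-edge⇔slot u≤v
  ... | inj₂ v≤u = ⇔.trans (mk⇔ Edge-sym Edge-sym)
    (subst (λ S → Edge G v u ⇔ (∃[ j ] (j < r × InSlot j S)))
           (+-comm (weight v) (weight u)) (upward-edge⇔slot v≤u))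

  interval : Fin r → Interval
  interval j = ⟦ incl (toℚ (slot-lo (toℕ j))) , incl (toℚ (slot-hi (toℕ j))) ⟧

  ∈interval⇔ : ∀ {S} j → (toℚ S ∈ᴵ interval j) ⇔ InSlot (toℕ j) S
  ∈interval⇔ j = mk⇔ (map toℚ-cancel-≤ toℚ-cancel-≤) (map toℚ-mono-≤ toℚ-mono-≤)

  pair-≤ : ∀ i {j} → j < r → slot-lo i ≤ slot-hi j → pair i ≤ pair j
  pair-≤ i j<r lo≤hi = quotient-≤ Q (window-hi<Q j<r) (≤-trans (m≤m+n _ _) lo≤hi) ≤-refl

  intervals-disjoint : ∀ i j → i ≢ j → ∀ x → ¬ (x ∈ᴵ interval i × x ∈ᴵ interval j)
  intervals-disjoint i j i≢j x ((loᵢ≤x , x≤hiᵢ) , (loⱼ≤x , x≤hiⱼ)) =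
    i≢j (Fin.toℕ-injective (proj₁ (2^-pair (n≤1+n (toℕ i)) (≤-antisym
      (pair-≤ (toℕ i) (Fin.toℕ<n j) (toℚ-cancel-≤ (ℚ.≤-trans loᵢ≤x x≤hiⱼ)))
      (pair-≤ (toℕ j) (Fin.toℕ<n i) (toℚ-cancel-≤ (ℚ.≤-trans loⱼ≤x x≤hiᵢ)))))))

  weight-pos : ∀ v → 0 < weight v
  weight-pos v = ≤-trans (≤-trans (m^n>0 2 (level v)) (m≤n*m (2 ^ level v) Q)) (m≤m+n _ (entry v))

  slot⇔interval : ∀ S → (∃[ j ] (j < r × InSlot j S)) ⇔ (∃[ i ] (toℚ S ∈ᴵ interval i))
  slot⇔interval S = mk⇔
    (λ (j , j<r , slot) → Fin.fromℕ< j<r , Equivalence.from (∈interval⇔ (Fin.fromℕ< j<r))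
                            (subst (λ k → InSlot k S) (sym (Fin.toℕ-fromℕ< j<r)) slot))
    (λ (i , S∈i) → toℕ i , Fin.toℕ<n i , Equivalence.to (∈interval⇔ i) S∈i)

  starPCG : StarPCG G r
  starPCG = toℚ ∘ weight , interval , toℚ-pos ∘ weight-pos , intervals-disjoint , λ u v _ →
    ⇔.trans (edge⇔slot u v)
      (subst (λ x → (∃[ j ] (j < r × InSlot j (weight u + weight v))) ⇔ (∃[ i ] (x ∈ᴵ interval i)))
             (sym (toℚ-+ (weight u) (weight v)))
        (slot⇔interval (weight u + weight v)))

theorem9 : ∀ (n : ℕ) (G : Graph n) → Forest G → HasEdge G →
    ∀ (r : ℕ) → Rad G r → StarNumber≤ G r
theorem9 n G forest (_ , _ , e) r rad = r , depth≥1 level≤r e , ≤-refl , starPCG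
  where
  open Centres G rad using (rooting; level≤r)
  open Rooting rooting using (level; parent; parent-edge)
  open TreeEdges rooting using (depth≥1; tree-edge)
  open Construction {G = G} level parent level≤r parent-edge (tree-edge forest) using (starPCG)
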